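{- Let $\mathbb{F}$ be a finite field, $m\in\mathbb{N}$, $\vec d=(d_1,\dots,d_m)\in\mathbb{N}^m$, $I\subseteq\mathbb{F}^m$, $S_1,\dots,S_m\subseteq\mathbb{F}$ nonempty, and $\mathcal{S}=S_1\times\cdots\times S_m$. If there exists a constraint $z:I\cup\mathcal{S}\to\mathbb{F}$ on $I\cup\mathcal{S}$ with respect to $\mathrm{RM}[\mathbb{F},m,\vec d]$ such that $z(w)\neq0$ for some $w\in\mathcal{S}$, then $w$ is determined by $I$ with respect to $\mathrm{RM}[\mathbb{F},m,\vec d']$, where $\vec d'=(d_1-(|S_1|-1),\dots,d_m-(|S_m|-1))$.
   Context: $\mathrm{RM}[\mathbb{F},m,\vec d]$ is the code of evaluation tables over $\mathbb{F}^m$ of polynomials with $\deg_{X_i}\le d_i$. For a linear code $C\subseteq\mathbb{F}^D$ and $J\subseteq D$, a constraint on $J$ with respect to $C$ is a nonzero $z\in\mathbb{F}^J$ with $\sum_{x\in J}z(x)c(x)=0$ for all $c\in C$. A set $I\subseteq D$ determines $x\in D$ with respect to $C$ if $x\in I$ or there is a constraint $z$ on $I\cup\{x\}$ with respect to $C$ such that $z(x)\neq0$. -}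

module Defs where

open import Level using (Level; _⊔_) renaming (suc to lsuc)
open import Algebra.Bundles using (CommutativeRing)
open import Data.Nat using (ℕ; zero; suc)
open import Data.Integer using (ℤ; +_; _-_) renaming (_≤_ to _≤ℤ_)
open import Data.Fin using (Fin)
open import Data.Vec using (Vec; []; _∷_; lookup)
import Data.Vec
open import Data.List using (List; []; _∷_; map; concatMap; foldr; length)
open import Data.List.Membership.Propositional using (_∈_)
open import Data.List.Relation.Unary.All using (All)
open import Data.List.Relation.Unary.Unique.Propositional using (Unique)
open import Data.Product using (Σ; ∃; _×_; _,_; proj₁; proj₂)
open import Data.Sum using (_⊎_)
open import Relation.Nullary using (¬_)
open import Relation.Binary.PropositionalEquality using (_≡_)

record FiniteField (c ℓ : Level) : Set (lsuc (c ⊔ ℓ)) where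
  field
    commRing : CommutativeRing c ℓ
  open CommutativeRing commRing public
  field
    0≉1       : ¬ (0# ≈ 1#)
    inverse   : ∀ x → ¬ (x ≈ 0#) → ∃ λ y → x * y ≈ 1#
    ≈⇒≡       : ∀ {x y} → x ≈ y → x ≡ y
    elems     : List Carrier
    complete  : ∀ x → x ∈ elems
    unique    : Unique elems

module Over {c ℓ : Level} (F : FiniteField c ℓ) where
  open FiniteField F public

  Point : ℕ → Set c
  Point m = Vec Carrier m

  allPoints : (m : ℕ) → List (Point m)
  allPoints zero    = [] ∷ []
  allPoints (suc m) = concatMap (λ a → map (a ∷_) (allPoints m)) elems

  Σ-list : List Carrier → Carrier
  Σ-list = foldr _+_ 0#

  pow : Carrier → ℕ → Carrier
  pow a zero    = 1#
  pow a (suc n) = a * pow a n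

  monomial : ∀ {m} → Vec ℕ m → Point m → Carrier
  monomial []       []       = 1#
  monomial (e ∷ es) (a ∷ as) = pow a e * monomial es as

  Word : ℕ → Set c
  Word m = Point m → Carrier

  -- Degree bounds are integers so that negative
  -- bounds are allowed (then only the zero polynomial qualifies).
  RM : (m : ℕ) → Vec ℤ m → Word m → Set (c ⊔ ℓ)
  RM m d w = ∃ λ (p : List (Carrier × Vec ℕ m)) →
      All (λ t → ∀ (i : Fin m) → + (lookup (proj₂ t) i) ≤ℤ lookup d i) p
    × (∀ x → w x ≈ Σ-list (map (λ t → proj₁ t * monomial (proj₂ t) x) p))

  Subset : ℕ → Set (lsuc c)
  Subset m = Point m → Set c

  _∪_ : ∀ {m} → Subset m → Subset m → Subset m
  (A ∪ B) x = A x ⊎ B x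

  ⟦_⟧ : ∀ {m} → Point m → Subset m
  ⟦ y ⟧ x = x ≡ y

  -- z is a constraint on J w.r.t. the code C: a nonzero element of F^J
  -- (z vanishes outside J), orthogonal to every codeword.
  IsConstraint : ∀ {m} → (Word m → Set (c ⊔ ℓ)) → Subset m → Word m → Set (c ⊔ ℓ)
  IsConstraint {m} C J z =
      (∀ x → ¬ J x → z x ≈ 0#)
    × (∃ λ x → ¬ (z x ≈ 0#))
    × (∀ cw → C cw → Σ-list (map (λ x → z x * cw x) (allPoints m)) ≈ 0#)

  Determines : ∀ {m} → (Word m → Set (c ⊔ ℓ)) → Subset m → Point m → Set (c ⊔ ℓ)
  Determines C I x = I x ⊎ ∃ λ z → IsConstraint C (I ∪ ⟦ x ⟧) z × ¬ (z x ≈ 0#)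

  Box : ∀ {m} → Vec (List Carrier) m → Subset m
  Box S x = ∀ i → lookup x i ∈ lookup S i

reducedDegrees : ∀ {a} {A : Set a} {m} → Vec ℕ m → Vec (List A) m → Vec ℤ m
reducedDegrees d S = Data.Vec.tabulate (λ i → + lookup d i - (+ length (lookup S i) - + 1))

-- Multiply the constraint z by P = ∏ᵢ ∏_{s ∈ Sᵢ, s ≠ wᵢ} (Xᵢ − s).  P vanishes on
-- 𝒮 ∖ {w} and not at w, so z·P is supported on I ∪ {w} and nonzero at w; and
-- since deg_{Xᵢ} P ≤ |Sᵢ| − 1, multiplication by P maps RM[𝔽, m, d′] into
-- RM[𝔽, m, d], so z·P is orthogonal to RM[𝔽, m, d′].
module Submission where

open import Defs
open import Level using (Level; _⊔_)
open import Data.Nat using (ℕ)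
open import Data.Integer using (+_)
open import Data.Fin using (Fin)
open import Data.Vec using (Vec; lookup; map)
open import Data.List using (List; [])
open import Data.List.Relation.Unary.Unique.Propositional using (Unique)
open import Relation.Nullary using (¬_)
open import Relation.Binary.PropositionalEquality using (_≢_)

open import Relation.Binary.PropositionalEquality using (_≡_)

import Algebra.Properties.CommutativeSemigroup as CommutativeSemigroupProperties
import Algebra.Properties.Group as GroupProperties
import Data.Fin as Fin
import Data.Fin.Properties as Finₚ
import Data.Integer as ℤ
import Data.Integer.Properties as ℤₚ
import Data.List as L
import Data.List.Membership.DecPropositional as DecMembership
import Data.List.Membership.Propositional.Properties as Membershipₚ
import Data.List.Membership.Setoid.Properties as SetoidMembershipₚ
import Data.List.Properties as Lₚ
import Data.List.Relation.Unary.All.Properties as Allₚ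
import Data.Nat as ℕ
import Data.Nat.Properties as ℕₚ
import Data.Vec as V
import Data.Vec.Properties as Vₚ
import Relation.Binary.PropositionalEquality as ≡
import Relation.Binary.Reasoning.Setoid
open import Data.List.Membership.Propositional using (_∈_; _∉_)
open import Data.List.Relation.Unary.All as All using (All; []; _∷_)
open import Data.List.Relation.Unary.Any as Any using (here; there)
open import Data.Empty using (⊥-elim)
open import Data.Product using (∃; _×_; _,_; proj₁; proj₂)
open import Data.Sum using (inj₁; inj₂; [_,_])
open import Function using (_∘_)
open import Relation.Binary.Definitions using (DecidableEquality)
open import Relation.Nullary using (Dec; yes; no; ¬?)
import Relation.Nullary.Decidable as Dec

i≤j⇒i+[k-j]≤k : ∀ {i j} k → i ℤ.≤ j → i ℤ.+ (k ℤ.- j) ℤ.≤ k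
i≤j⇒i+[k-j]≤k {i} {j} k i≤j = begin
  i ℤ.+ (k ℤ.- j)       ≤⟨ ℤₚ.+-monoˡ-≤ (k ℤ.- j) i≤j ⟩
  j ℤ.+ (k ℤ.- j)       ≡⟨ ℤₚ.+-comm j (k ℤ.- j) ⟩
  k ℤ.- j ℤ.+ j         ≡⟨ ℤₚ.+-assoc k (ℤ.- j) j ⟩
  k ℤ.+ (ℤ.- j ℤ.+ j)   ≡⟨ ≡.cong (ℤ._+_ k) (ℤₚ.+-inverseˡ j) ⟩
  k ℤ.+ + 0             ≡⟨ ℤₚ.+-identityʳ k ⟩
  k                     ∎
  where open ℤₚ.≤-Reasoning

n<m⇒+n+[k-[+m-1]]≤k : ∀ {n m} k → n ℕ.< m → + n ℤ.+ (k ℤ.- (+ m ℤ.- + 1)) ℤ.≤ k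
n<m⇒+n+[k-[+m-1]]≤k k (ℕ.s≤s n≤m-1) = i≤j⇒i+[k-j]≤k k (ℤ.+≤+ n≤m-1)

module _ {c ℓ : Level} (F : FiniteField c ℓ) where
  open Over F
  open CommutativeSemigroupProperties *-commutativeSemigroup
    using () renaming (interchange to *-interchange)
  open GroupProperties +-group using (x∙y⁻¹≈ε⇒x≈y)
  module ≈-Reasoning = Relation.Binary.Reasoning.Setoid setoid

  _≟_ : DecidableEquality Carrier
  x ≟ y = Dec.map′ (index-injective (≡.setoid Carrier) (complete x) (complete y))
                   (≡.cong (Any.index ∘ complete))
                   (Any.index (complete x) Fin.≟ Any.index (complete y))
    where open SetoidMembershipₚ using (index-injective)

  open DecMembership _≟_ using (_∈?_)

  x≉0∧y≉0⇒x*y≉0 : ∀ {x y} → x ≉ 0# → y ≉ 0# → x * y ≉ 0#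
  x≉0∧y≉0⇒x*y≉0 {x} {y} x≉0 y≉0 xy≈0 with inverse x x≉0
  ... | x⁻¹ , xx⁻¹≈1 = y≉0 (begin
    y                ≈⟨ sym (*-identityˡ y) ⟩
    1# * y           ≈⟨ *-congʳ (sym xx⁻¹≈1) ⟩
    (x * x⁻¹) * y    ≈⟨ *-congʳ (*-comm x x⁻¹) ⟩
    (x⁻¹ * x) * y    ≈⟨ *-assoc x⁻¹ x y ⟩
    x⁻¹ * (x * y)    ≈⟨ *-congˡ xy≈0 ⟩
    x⁻¹ * 0#         ≈⟨ zeroʳ x⁻¹ ⟩
    0#               ∎)
    where open ≈-Reasoning

  Σ-list-cong : ∀ {A : Set c} {f g : A → Carrier} → (∀ a → f a ≈ g a) →
                ∀ as → Σ-list (L.map f as) ≈ Σ-list (L.map g as)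
  Σ-list-cong f≈g L.[]       = refl
  Σ-list-cong f≈g (a L.∷ as) = +-cong (f≈g a) (Σ-list-cong f≈g as)

  Term : ℕ → Set c
  Term m = Carrier × Vec ℕ m

  evalTerm : ∀ {m} → Term m → Point m → Carrier
  evalTerm t x = proj₁ t * monomial (proj₂ t) x

  eval : ∀ {m} → List (Term m) → Point m → Carrier
  eval p x = Σ-list (L.map (λ t → evalTerm t x) p)

  Bounded : ∀ {m} → Vec ℤ.ℤ m → Term m → Set
  Bounded D t = ∀ i → + lookup (proj₂ t) i ℤ.≤ lookup D i

  eval-++ : ∀ {m} (p q : List (Term m)) x → eval (p L.++ q) x ≈ eval p x + eval q x
  eval-++ L.[]       q x = sym (+-identityˡ _)
  eval-++ (t L.∷ p) q x = trans (+-congˡ (eval-++ p q x)) (sym (+-assoc _ _ _))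

  pow-+ : ∀ a k n → pow a (k ℕ.+ n) ≈ pow a k * pow a n
  pow-+ a ℕ.zero    n = sym (*-identityˡ _)
  pow-+ a (ℕ.suc k) n = trans (*-congˡ (pow-+ a k n)) (sym (*-assoc _ _ _))

  monomial-+ : ∀ {m} (e f : Vec ℕ m) x →
               monomial (V.zipWith ℕ._+_ e f) x ≈ monomial e x * monomial f x
  monomial-+ V.[]       V.[]       V.[]       = sym (*-identityˡ _)
  monomial-+ (k V.∷ e) (n V.∷ f) (a V.∷ x) =
    trans (*-cong (pow-+ a k n) (monomial-+ e f x)) (*-interchange _ _ _ _)

  _*ₜ_ : ∀ {m} → Term m → Term m → Term m
  (a , e) *ₜ (b , f) = a * b , V.zipWith ℕ._+_ e f

  _*ₚ_ : ∀ {m} → List (Term m) → List (Term m) → List (Term m)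
  _*ₚ_ = L.cartesianProductWith _*ₜ_

  evalTerm-*ₜ : ∀ {m} (t u : Term m) x → evalTerm (t *ₜ u) x ≈ evalTerm t x * evalTerm u x
  evalTerm-*ₜ (a , e) (b , f) x = trans (*-congˡ (monomial-+ e f x)) (*-interchange _ _ _ _)

  eval-map-*ₜ : ∀ {m} (t : Term m) q x → eval (L.map (t *ₜ_) q) x ≈ evalTerm t x * eval q x
  eval-map-*ₜ t L.[]       x = sym (zeroʳ _)
  eval-map-*ₜ t (u L.∷ q) x =
    trans (+-cong (evalTerm-*ₜ t u x) (eval-map-*ₜ t q x)) (sym (distribˡ _ _ _))

  eval-*ₚ : ∀ {m} (p q : List (Term m)) x → eval (p *ₚ q) x ≈ eval p x * eval q x
  eval-*ₚ L.[]       q x = sym (zeroˡ _)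
  eval-*ₚ (t L.∷ p) q x = begin
    eval (L.map (t *ₜ_) q L.++ p *ₚ q) x       ≈⟨ eval-++ (L.map (t *ₜ_) q) (p *ₚ q) x ⟩
    eval (L.map (t *ₜ_) q) x + eval (p *ₚ q) x ≈⟨ +-cong (eval-map-*ₜ t q x) (eval-*ₚ p q x) ⟩
    evalTerm t x * eval q x + eval p x * eval q x ≈⟨ sym (distribʳ _ _ _) ⟩
    (evalTerm t x + eval p x) * eval q x       ∎
    where open ≈-Reasoning

  Bounded-*ₜ : ∀ {m} (D₁ D₂ D : Vec ℤ.ℤ m) →
               (∀ i → lookup D₁ i ℤ.+ lookup D₂ i ℤ.≤ lookup D i) →
               ∀ t u → Bounded D₁ t → Bounded D₂ u → Bounded D (t *ₜ u)
  Bounded-*ₜ D₁ D₂ D D₁+D₂≤D (_ , e) (_ , f) t≤D₁ u≤D₂ i = begin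
    + lookup (V.zipWith ℕ._+_ e f) i     ≡⟨ ≡.cong +_ (Vₚ.lookup-zipWith ℕ._+_ i e f) ⟩
    + lookup e i ℤ.+ + lookup f i        ≤⟨ ℤₚ.+-mono-≤ (t≤D₁ i) (u≤D₂ i) ⟩
    lookup D₁ i ℤ.+ lookup D₂ i          ≤⟨ D₁+D₂≤D i ⟩
    lookup D i                           ∎
    where open ℤₚ.≤-Reasoning

  RM-* : ∀ {m} (D₁ D₂ D : Vec ℤ.ℤ m) {f g : Word m} →
         (∀ i → lookup D₁ i ℤ.+ lookup D₂ i ℤ.≤ lookup D i) →
         RM m D₁ f → RM m D₂ g → RM m D (λ x → f x * g x)
  RM-* D₁ D₂ D D₁+D₂≤D (p , p≤D₁ , f≈p) (q , q≤D₂ , g≈q) =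
    p *ₚ q ,
    Allₚ.cartesianProductWith⁺ (≡.setoid _) (≡.setoid _) _*ₜ_ p q
      (λ {t} {u} t∈p u∈q →
        Bounded-*ₜ D₁ D₂ D D₁+D₂≤D t u (All.lookup p≤D₁ t∈p) (All.lookup q≤D₂ u∈q)) ,
    λ x → trans (*-cong (f≈p x) (g≈q x)) (sym (eval-*ₚ p q x))

  0ᵛ : (m : ℕ) → Vec ℤ.ℤ m
  0ᵛ m = V.replicate m (+ 0)

  0ᵛ-+ : ∀ {m} (i : Fin m) k → lookup (0ᵛ m) i ℤ.+ k ≡ k
  0ᵛ-+ i k = ≡.trans (≡.cong (ℤ._+ k) (Vₚ.lookup-replicate i (+ 0))) (ℤₚ.+-identityˡ k)

  monomial-0 : ∀ {m} (x : Point m) → monomial (V.replicate m 0) x ≈ 1#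
  monomial-0 V.[]       = refl
  monomial-0 (a V.∷ x) = trans (*-identityˡ _) (monomial-0 x)

  0ᵉ≤0ᵛ : ∀ {m} (i : Fin m) → + lookup (V.replicate m 0) i ℤ.≤ lookup (0ᵛ m) i
  0ᵉ≤0ᵛ i = ℤₚ.≤-reflexive (≡.trans (≡.cong +_ (Vₚ.lookup-replicate i 0))
                                          (≡.sym (Vₚ.lookup-replicate i (+ 0))))

  RM-1 : ∀ {m} → RM m (0ᵛ m) (λ _ → 1#)
  RM-1 {m} = (1# , V.replicate m 0) L.∷ L.[] , 0ᵉ≤0ᵛ ∷ [] ,
    λ x → sym (trans (+-identityʳ _) (trans (*-identityˡ _) (monomial-0 x)))

  RM-head-sub : ∀ {m} s → RM (ℕ.suc m) (+ 1 V.∷ 0ᵛ m) (λ x → V.head x - s)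
  RM-head-sub {m} s =
    (1# , 1 V.∷ V.replicate m 0) L.∷ (- s , 0 V.∷ V.replicate m 0) L.∷ L.[] ,
    (λ { Fin.zero → ℤₚ.≤-refl ; (Fin.suc i) → 0ᵉ≤0ᵛ i }) ∷
    (λ { Fin.zero → ℤ.+≤+ ℕ.z≤n ; (Fin.suc i) → 0ᵉ≤0ᵛ i }) ∷ [] ,
    λ { (a V.∷ x) → sym (begin
      1# * (a * 1# * monomial 0ᵉ x) + (- s * (1# * monomial 0ᵉ x) + 0#)
        ≈⟨ +-cong (*-identityˡ _) (+-identityʳ _) ⟩
      a * 1# * monomial 0ᵉ x + - s * (1# * monomial 0ᵉ x)
        ≈⟨ +-cong (*-cong (*-identityʳ a) (monomial-0 x))
                  (*-congˡ (trans (*-identityˡ _) (monomial-0 x))) ⟩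
      a * 1# + - s * 1#
        ≈⟨ +-cong (*-identityʳ a) (*-identityʳ (- s)) ⟩
      a - s ∎) }
    where
      open ≈-Reasoning
      0ᵉ : Vec ℕ m
      0ᵉ = V.replicate m 0

  RM-∘tail : ∀ {m D} {f : Word m} → RM m D f → RM (ℕ.suc m) (+ 0 V.∷ D) (f ∘ V.tail)
  RM-∘tail (p , p≤D , f≈p) =
    L.map lift p ,
    Allₚ.map⁺ (All.map (λ t≤D → λ { Fin.zero → ℤₚ.≤-refl ; (Fin.suc i) → t≤D i }) p≤D) ,
    λ { (a V.∷ x) → trans (f≈p x) (sym (eval-lift p a x)) }
    where
      lift : ∀ {m} → Term m → Term (ℕ.suc m)
      lift (b , e) = b , 0 V.∷ e
      eval-lift : ∀ {m} (p : List (Term m)) a x → eval (L.map lift p) (a V.∷ x) ≈ eval p x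
      eval-lift L.[]       a x = refl
      eval-lift (t L.∷ p) a x = +-cong (*-congˡ (*-identityˡ _)) (eval-lift p a x)

  vanishing : List Carrier → Carrier → Carrier
  vanishing L.[]       a = 1#
  vanishing (s L.∷ T) a = (a - s) * vanishing T a

  vanishing-root : ∀ {a} T → a ∈ T → vanishing T a ≈ 0#
  vanishing-root (s L.∷ T) (here ≡.refl) = trans (*-congʳ (-‿inverseʳ s)) (zeroˡ _)
  vanishing-root (s L.∷ T) (there a∈T)   = trans (*-congˡ (vanishing-root T a∈T)) (zeroʳ _)

  vanishing-nonroot : ∀ {a} T → a ∉ T → vanishing T a ≉ 0#
  vanishing-nonroot L.[]       a∉T = 0≉1 ∘ sym
  vanishing-nonroot (s L.∷ T) a∉T = x≉0∧y≉0⇒x*y≉0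
    (λ a-s≈0 → a∉T (here (≈⇒≡ (x∙y⁻¹≈ε⇒x≈y _ _ a-s≈0))))
    (vanishing-nonroot T (a∉T ∘ there))

  RM-vanishing : ∀ {m} T → RM (ℕ.suc m) (+ L.length T V.∷ 0ᵛ m) (vanishing T ∘ V.head)
  RM-vanishing L.[]       = RM-1
  RM-vanishing {m} (s L.∷ T) =
    RM-* (+ 1 V.∷ 0ᵛ m) (+ L.length T V.∷ 0ᵛ m) (+ L.length (s L.∷ T) V.∷ 0ᵛ m)
         degree-bound (RM-head-sub s) (RM-vanishing T)
    where
      degree-bound : ∀ i → lookup (+ 1 V.∷ 0ᵛ m) i ℤ.+ lookup (+ L.length T V.∷ 0ᵛ m) i
                          ℤ.≤ lookup (+ L.length (s L.∷ T) V.∷ 0ᵛ m) i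
      degree-bound Fin.zero    = ℤₚ.≤-refl
      degree-bound (Fin.suc i) = ℤₚ.≤-reflexive (0ᵛ-+ i _)

  degrees : ∀ {m} → Vec (List Carrier) m → Vec ℤ.ℤ m
  degrees = V.map (+_ ∘ L.length)

  boxVanishing : ∀ {m} → Vec (List Carrier) m → Word m
  boxVanishing V.[]       x = 1#
  boxVanishing (T V.∷ Ts) x = vanishing T (V.head x) * boxVanishing Ts (V.tail x)

  boxVanishing-root : ∀ {m} (Ts : Vec (List Carrier) m) x →
                      (∃ λ i → lookup x i ∈ lookup Ts i) → boxVanishing Ts x ≈ 0#
  boxVanishing-root (T V.∷ Ts) (a V.∷ x) (Fin.zero , a∈T) =
    trans (*-congʳ (vanishing-root T a∈T)) (zeroˡ _)
  boxVanishing-root (T V.∷ Ts) (a V.∷ x) (Fin.suc i , xᵢ∈Tᵢ) =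
    trans (*-congˡ (boxVanishing-root Ts x (i , xᵢ∈Tᵢ))) (zeroʳ _)

  boxVanishing-nonroot : ∀ {m} (Ts : Vec (List Carrier) m) x →
                         (∀ i → lookup x i ∉ lookup Ts i) → boxVanishing Ts x ≉ 0#
  boxVanishing-nonroot V.[]       V.[]       _      = 0≉1 ∘ sym
  boxVanishing-nonroot (T V.∷ Ts) (a V.∷ x) x∉Ts =
    x≉0∧y≉0⇒x*y≉0 (vanishing-nonroot T (x∉Ts Fin.zero))
                  (boxVanishing-nonroot Ts x (x∉Ts ∘ Fin.suc))

  RM-boxVanishing : ∀ {m} (Ts : Vec (List Carrier) m) → RM m (degrees Ts) (boxVanishing Ts)
  RM-boxVanishing V.[]       = RM-1
  RM-boxVanishing (T V.∷ Ts) =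
    RM-* (+ L.length T V.∷ 0ᵛ _) (+ 0 V.∷ degrees Ts) (degrees (T V.∷ Ts))
         degree-bound (RM-vanishing T) (RM-∘tail (RM-boxVanishing Ts))
    where
      degree-bound : ∀ i → lookup (+ L.length T V.∷ 0ᵛ _) i ℤ.+ lookup (+ 0 V.∷ degrees Ts) i
                          ℤ.≤ lookup (degrees (T V.∷ Ts)) i
      degree-bound Fin.zero    = ℤₚ.≤-reflexive (≡.cong +_ (ℕₚ.+-identityʳ _))
      degree-bound (Fin.suc i) = ℤₚ.≤-reflexive (0ᵛ-+ i _)

  without : Carrier → List Carrier → List Carrier
  without a = L.filter (λ s → ¬? (s ≟ a))

  puncture : ∀ {m} → Vec (List Carrier) m → Point m → Vec (List Carrier) m
  puncture V.[]       V.[]       = V.[]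
  puncture (T V.∷ Ts) (a V.∷ w) = without a T V.∷ puncture Ts w

  box? : ∀ {m} (S : Vec (List Carrier) m) x → Dec (Box S x)
  box? S x = Finₚ.all? (λ i → lookup x i ∈? lookup S i)

  ∉-puncture : ∀ {m} (S : Vec (List Carrier) m) w i → lookup w i ∉ lookup (puncture S w) i
  ∉-puncture (T V.∷ S) (a V.∷ w) Fin.zero    a∈T∖a =
    proj₂ (Membershipₚ.∈-filter⁻ (λ s → ¬? (s ≟ a)) {xs = T} a∈T∖a) ≡.refl
  ∉-puncture (T V.∷ S) (a V.∷ w) (Fin.suc i) = ∉-puncture S w i

  ∈-puncture : ∀ {m} (S : Vec (List Carrier) m) {w x} → Box S x → x ≢ w →
               ∃ λ i → lookup x i ∈ lookup (puncture S w) i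
  ∈-puncture V.[]       {V.[]}     {V.[]}     _   []≢[] = ⊥-elim ([]≢[] ≡.refl)
  ∈-puncture (T V.∷ S) {b V.∷ w} {a V.∷ x} x∈S x≢w with a ≟ b
  ... | yes ≡.refl = let i , xᵢ∈Sᵢ = ∈-puncture S (x∈S ∘ Fin.suc) (x≢w ∘ ≡.cong (a V.∷_))
                     in Fin.suc i , xᵢ∈Sᵢ
  ... | no a≢b     = Fin.zero , Membershipₚ.∈-filter⁺ _ (x∈S Fin.zero) a≢b

  length-puncture : ∀ {m} (S : Vec (List Carrier) m) {w} → Box S w →
                    ∀ i → L.length (lookup (puncture S w) i) ℕ.< L.length (lookup S i)
  length-puncture (T V.∷ S) {a V.∷ w} w∈S Fin.zero =
    Lₚ.filter-notAll (λ s → ¬? (s ≟ a)) T (Any.map (λ a≡s s≢a → s≢a (≡.sym a≡s)) (w∈S Fin.zero))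
  length-puncture (T V.∷ S) {a V.∷ w} w∈S (Fin.suc i) = length-puncture S (w∈S ∘ Fin.suc) i

  degrees-puncture+reducedDegrees≤d : ∀ {m} (d : Vec ℕ m) S w → Box S w → ∀ i →
    lookup (degrees (puncture S w)) i ℤ.+ lookup (reducedDegrees d S) i ℤ.≤ lookup (map +_ d) i
  degrees-puncture+reducedDegrees≤d d S w w∈S i = begin
    lookup (degrees (puncture S w)) i ℤ.+ lookup (reducedDegrees d S) i
      ≡⟨ ≡.cong₂ ℤ._+_ (Vₚ.lookup-map i _ (puncture S w)) (Vₚ.lookup∘tabulate _ i) ⟩
    + L.length (lookup (puncture S w) i) ℤ.+ (+ lookup d i ℤ.- (+ L.length (lookup S i) ℤ.- + 1))
      ≤⟨ n<m⇒+n+[k-[+m-1]]≤k (+ lookup d i) (length-puncture S w∈S i) ⟩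
    + lookup d i
      ≡⟨ Vₚ.lookup-map i +_ d ⟨
    lookup (map +_ d) i ∎
    where open ℤₚ.≤-Reasoning

  multiplier-determines :
    ∀ {m} {C C′ : Word m → Set (c ⊔ ℓ)} {I B : Subset m} {z : Word m} {w : Point m}
    (P : Word m) → (∀ x → Dec (B x)) → (∀ f → C′ f → C (λ x → P x * f x)) →
    (∀ x → B x → x ≢ w → P x ≈ 0#) → P w ≉ 0# →
    IsConstraint C (I ∪ B) z → z w ≉ 0# → Determines C′ I w
  multiplier-determines {m} {C′ = C′} {I} {z = z} {w}
                        P B? P*C′⊆C P-vanishes Pw≉0 (z-support , _ , z⊥C) zw≉0 =
    inj₂ (zP , (zP-support , (w , zPw≉0) , zP⊥C′) , zPw≉0)
    where
      zP : Word m
      zP x = z x * P x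
      zPw≉0 : zP w ≉ 0#
      zPw≉0 = x≉0∧y≉0⇒x*y≉0 zw≉0 Pw≉0
      zP-support : ∀ x → ¬ (I ∪ ⟦ w ⟧) x → zP x ≈ 0#
      zP-support x x∉I∪w with B? x
      ... | yes x∈B = trans (*-congˡ (P-vanishes x x∈B (x∉I∪w ∘ inj₂))) (zeroʳ _)
      ... | no  x∉B = trans (*-congʳ (z-support x [ x∉I∪w ∘ inj₁ , x∉B ])) (zeroˡ _)
      zP⊥C′ : ∀ f → C′ f → Σ-list (L.map (λ x → zP x * f x) (allPoints m)) ≈ 0#
      zP⊥C′ f f∈C′ = trans (Σ-list-cong (λ x → *-assoc (z x) (P x) (f x)) (allPoints m))
                           (z⊥C _ (P*C′⊆C f f∈C′))

lemma5p12 : ∀ {c ℓ : Level} (F : FiniteField c ℓ) → let open Over F in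
    (m : ℕ) (d : Vec ℕ m) (I : Subset m) (S : Vec (List Carrier) m) →
    (∀ i → Unique (lookup S i)) → (∀ i → lookup S i ≢ []) →
    (z : Word m) (w : Point m) →
    IsConstraint (RM m (map +_ d)) (I ∪ Box S) z →
    Box S w → ¬ (z w ≈ 0#) →
    Determines (RM m (reducedDegrees d S)) I w
lemma5p12 F m d I S _ _ z w z-constraint w∈S zw≉0 =
  multiplier-determines F P (box? F S) P*RM[d′]⊆RM[d]
    (λ x x∈S x≢w → boxVanishing-root F S′ x (∈-puncture F S x∈S x≢w))
    (boxVanishing-nonroot F S′ w (∉-puncture F S w))
    z-constraint zw≉0
  where
    open Over F using (RM; _*_)
    S′ : Vec (List (Over.Carrier F)) m
    S′ = puncture F S w
    P : Over.Word F m
    P = boxVanishing F S′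
    P*RM[d′]⊆RM[d] : ∀ f → RM m (reducedDegrees d S) f → RM m (map +_ d) (λ x → P x * f x)
    P*RM[d′]⊆RM[d] f f∈RM[d′] =
      RM-* F (degrees F S′) (reducedDegrees d S) (map +_ d)
        (degrees-puncture+reducedDegrees≤d F d S w w∈S) (RM-boxVanishing F S′) f∈RM[d′]
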